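{- Let $H_1$ and $H_2$ be hypergraphs. Then $H_1\cong H_2$ if and only if $\#\mathrm{TrimHom}(H_1,G)=\#\mathrm{TrimHom}(H_2,G)$ for all hypergraphs $G$.
   Context: A hypergraph is a pair $H=(V,E)$ with $V$ finite and $E\subseteq2^V\setminus\{\varnothing\}$. A trimmed homomorphism from $H$ to $G$ is a map $\varphi:V(H)\to V(G)$ such that for every $e\in E(H)$ there exists $e'\in E(G)$ with $\varphi(e)=e'\cap\mathrm{img}(\varphi)$; $\mathrm{TrimHom}(H,G)$ is the set of these. -}

module Defs where

open import Data.Nat using (ℕ; zero; suc)
open import Data.Bool using (Bool; true; false)
open import Data.Fin using (Fin; zero; suc; _≟_)
open import Data.Fin.Subset using (Subset; _∈_; ⊥; ⊤; _∩_)
open import Data.Fin.Subset.Properties using (_∈?_; anySubset?)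
open import Data.Vec using (tabulate)
open import Data.Vec.Properties using (≡-dec)
open import Data.Bool.Properties using () renaming (_≟_ to _≟B_)
open import Data.List using (List; []; _∷_; map; concatMap; filter; length; allFin)
open import Data.Product using (Σ; ∃; ∃-syntax; _×_; _,_)
open import Function.Bundles using (_⤖_; Func; Bijection)
open import Relation.Nullary using (Dec; yes; no; ¬_; does)
open import Relation.Nullary.Decidable using (_×-dec_; map′)
open import Relation.Nullary using (¬?)
open import Relation.Binary.PropositionalEquality using (_≡_; refl)
open import Data.Fin.Properties using (any?; all?)

record Hypergraph : Set where
  field
    n      : ℕ
    E      : Subset n → Bool
    E-ne   : E ⊥ ≡ false

open Hypergraph public

IsEdge : (H : Hypergraph) → Subset (n H) → Set
IsEdge H e = E H e ≡ true

image : ∀ {a b} → (Fin a → Fin b) → Subset a → Subset b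
image φ e = tabulate (λ y → does (any? (λ x → (x ∈? e) ×-dec (φ x ≟ y))))

img : ∀ {a b} → (Fin a → Fin b) → Subset b
img φ = image φ ⊤

IsTrimHom : (H G : Hypergraph) → (Fin (n H) → Fin (n G)) → Set
IsTrimHom H G φ =
  ∀ (e : Subset (n H)) → IsEdge H e →
    ∃[ e' ] (IsEdge G e' × image φ e ≡ e' ∩ img φ)

private
  dec⇒ : ∀ {P Q : Set} → Dec P → Dec Q → Dec (P → Q)
  dec⇒ (yes p) (yes q) = yes (λ _ → q)
  dec⇒ (yes p) (no ¬q) = no (λ f → ¬q (f p))
  dec⇒ (no ¬p) _       = yes (λ p → Data.Empty.⊥-elim (¬p p))
    where import Data.Empty

  decAllSubset : ∀ {k} {P : Subset k → Set} → (∀ s → Dec (P s)) → Dec (∀ s → P s)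
  decAllSubset {P = P} P? with anySubset? (λ s → ¬? (P? s))
  ... | yes (s , ¬ps) = no (λ f → ¬ps (f s))
  ... | no ¬ex = yes (λ s → helper s (P? s))
    where
      helper : ∀ s → Dec (P s) → P s
      helper s (yes p) = p
      helper s (no ¬p) = Data.Empty.⊥-elim (¬ex (s , ¬p))
        where import Data.Empty

isTrimHom? : (H G : Hypergraph) → (φ : Fin (n H) → Fin (n G)) → Dec (IsTrimHom H G φ)
isTrimHom? H G φ =
  decAllSubset (λ e → dec⇒ (E H e ≟B true)
    (anySubset? (λ e' → (E G e' ≟B true) ×-dec ≡-dec _≟B_ (image φ e) (e' ∩ img φ))))

-- enumeration of all maps Fin a → Fin b (each exactly once, up to pointwise equality)
consF : ∀ {a b} → Fin b → (Fin a → Fin b) → Fin (suc a) → Fin b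
consF y f zero    = y
consF y f (suc i) = f i

allFuns : ∀ a b → List (Fin a → Fin b)
allFuns zero    b = (λ ()) ∷ []
allFuns (suc a) b = concatMap (λ f → map (λ y → consF y f) (allFin b)) (allFuns a b)

#TrimHom : Hypergraph → Hypergraph → ℕ
#TrimHom H G = length (filter (isTrimHom? H G) (allFuns (n H) (n G)))

_≅_ : Hypergraph → Hypergraph → Set
H₁ ≅ H₂ = Σ (Fin (n H₁) ⤖ Fin (n H₂)) λ f →
  ∀ (e : Subset (n H₁)) → E H₂ (image (Bijection.to f) e) ≡ E H₁ e

{-# OPTIONS --safe #-}
-- Isomorphic hypergraphs have the same counts, since precomposing with the vertex bijection
-- matches up the trimmed homomorphisms.
--
-- For the converse, let Cov(H, K, c) count the trimmed homomorphisms H → K whose image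
-- contains the vertices 0, …, c − 1 of K. A map into K that misses the vertex j = c is a
-- trimmed homomorphism exactly when it is one into K ∖ j, the hypergraph on the remaining
-- vertices whose edges are the nonempty traces e ∖ {j}. This gives
--   Cov(H, K, c) = Cov(H, K, c + 1) + Cov(H, K ∖ j, c),
-- so by induction on c the counts #TrimHom(H₁, –) = #TrimHom(H₂, –) force
-- Cov(H₁, K, c) = Cov(H₂, K, c) for every K. With K = H₂ and c = |V(H₂)|, the identity of H₂
-- makes this positive, so there is a surjective trimmed homomorphism H₁ → H₂, and
-- symmetrically one H₂ → H₁. Both are then vertex bijections that map edges to edges, and
-- composing them gives an injective, edge-preserving self-map of the finite set of vertex
-- subsets of H₁. Such a map also reflects edges, which yields the isomorphism.
module Submission where

open import Defs
open import Data.Product using (_×_)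
open import Relation.Binary.PropositionalEquality using (_≡_)

open import Algebra.Properties.CommutativeSemigroup using (xy∙z≈y∙xz)
open import Data.Bool using (Bool; true; false; _∧_; _∨_; if_then_else_)
open import Data.Bool.Properties using (∧-zeroʳ; ∨-zeroʳ)
open import Data.Empty using (⊥-elim)
open import Data.Fin using (Fin; zero; suc; toℕ; fromℕ<; punchIn; punchOut; funToFin; finToFun; _≟_)
open import Data.Fin.Permutation using (Permutation; _⟨$⟩ʳ_; _⟨$⟩ˡ_; inverseʳ; remove; punchIn-permute)
open import Data.Fin.Properties
  using (any?; all?; ¬Fin0; toℕ-injective; toℕ-fromℕ<; toℕ<n; punchIn-injective; punchInᵢ≢i; punchIn-punchOut;
         pigeonhole; injective⇒≤; 2↔Bool; finToFun-funToFin)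
open import Data.Fin.Subset using (Subset; _∈_; _⊆_; ⊥; ⊤; _∩_; inside; outside; Nonempty)
open import Data.Fin.Subset.Properties
  using (_∈?_; nonempty?; Empty-unique; ∉⊥; ∈⊤; ⊆-antisym; x∈p∩q⁻; ∩-identityʳ)
open import Data.List using (List; []; _∷_; map; concatMap; filter; length; allFin)
open import Data.List.Properties using (map-tabulate; map-cong; map-∘; map-concatMap)
open import Data.Nat using (ℕ; zero; suc; _+_; _*_; _^_; _<_; _≤_; _<?_; z<s; s<s; s<s⁻¹; z≤n; s≤s)
open import Data.Nat.GeneralisedArithmetic using (fold)
import Data.Nat.ListAction as List
open import Data.Nat.ListAction.Properties using (sum-++)
open import Data.Nat.Properties
  using (+-*-semiring; *-commutativeSemigroup; +-identityʳ; +-cancelʳ-≡; ≤-refl; ≤-reflexive; ≤-trans; ≤-<-trans;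
         <-irrefl; <⇒≱; m≤m+n; n≤1+n; n<1+n; m≤n⇒m≤1+n; m<n⇒m<1+n; m<1+n⇒m<n∨m≡n; module ≤-Reasoning)
open import Algebra.Properties.Semiring.Sum +-*-semiring
  using (sum; sum-cong-≗; ∑-distrib-+; ∑-comm; sum-remove; *-distribˡ-sum)
import Data.Product
open import Data.Product using (∃-syntax; _,_; proj₁; proj₂)
open import Data.Product.Function.NonDependent.Propositional using (_×-⇔_)
open import Data.Sum using (inj₁; inj₂)
open import Data.Vec using (_∷_; lookup; insertAt; removeAt)
open import Data.Vec.Properties
  using (lookup∘tabulate; tabulate∘lookup; tabulate-cong; lookup⇒[]=; []=⇒lookup;
         insertAt-lookup; insertAt-punchIn; removeAt-insertAt; insertAt-removeAt)
import Data.Vec.Functional as Func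
import Data.Vec.Functional.Properties as Funcₚ
open import Function using (_∘_; id)
open import Function.Bundles using (Bijection; Inverse; _⇔_; mk⇔; mk⤖)
open import Function.Consequences.Propositional using (strictlySurjective⇒surjective)
open import Function.Definitions using (Congruent; Injective; StrictlySurjective)
open import Function.Properties.Bijection using (⤖⇒↔)
open import Relation.Binary.Definitions using (Symmetric; _Respects_)
open import Relation.Binary.PropositionalEquality
  using (refl; sym; trans; cong; cong₂; subst; _≗_; _≢_; module ≡-Reasoning)
open import Relation.Nullary using (Dec; yes; no; does; ¬_; ¬?)
open import Relation.Nullary.Decidable using (dec-true; dec-false; does-⇔; decidable-stable; _×-dec_; _→-dec_)

private variable
  a b m : ℕ

does-true⇒ : ∀ {P : Set} (P? : Dec P) → does P? ≡ true → P
does-true⇒ (yes p) _ = p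

∈-image⁺ : (φ : Fin a → Fin b) {e : Subset a} {x : Fin a} → x ∈ e → φ x ∈ image φ e
∈-image⁺ φ {e} {x} x∈e = lookup⇒[]= (φ x) _
  (trans (lookup∘tabulate _ (φ x)) (dec-true (any? _) (x , x∈e , refl)))

∈-image⁻ : (φ : Fin a → Fin b) {e : Subset a} {y : Fin b} → y ∈ image φ e → ∃[ x ] x ∈ e × φ x ≡ y
∈-image⁻ φ {e} {y} y∈φe = does-true⇒ (any? (λ x → (x ∈? e) ×-dec (φ x ≟ y)))
  (trans (sym (lookup∘tabulate _ y)) ([]=⇒lookup y∈φe))

image-⊆ : (φ : Fin a → Fin b) {e : Subset a} {s : Subset b} →
  (∀ {x} → x ∈ e → φ x ∈ s) → image φ e ⊆ s
image-⊆ φ φe⊆s y∈φe with ∈-image⁻ φ y∈φe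
... | x , x∈e , refl = φe⊆s x∈e

image-cong : {φ ψ : Fin a → Fin b} → φ ≗ ψ → ∀ e → image φ e ≡ image ψ e
image-cong φ≗ψ e = ⊆-antisym (image-⊆ _ (reindex φ≗ψ)) (image-⊆ _ (reindex (sym ∘ φ≗ψ)))
  where
  reindex : ∀ {φ ψ} → φ ≗ ψ → ∀ {x} → x ∈ e → φ x ∈ image ψ e
  reindex {ψ = ψ} φ≗ψ {x} x∈e = subst (_∈ image ψ e) (sym (φ≗ψ x)) (∈-image⁺ ψ x∈e)

image-∘ : ∀ {c} (φ : Fin b → Fin c) (σ : Fin a → Fin b) e → image (φ ∘ σ) e ≡ image φ (image σ e)
image-∘ φ σ e = ⊆-antisym (image-⊆ _ (∈-image⁺ φ ∘ ∈-image⁺ σ)) (image-⊆ φ back)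
  where
  back : ∀ {y} → y ∈ image σ e → φ y ∈ image (φ ∘ σ) e
  back y∈σe with ∈-image⁻ σ y∈σe
  ... | x , x∈e , refl = ∈-image⁺ (φ ∘ σ) x∈e

image-id : (e : Subset a) → image id e ≡ e
image-id e = ⊆-antisym (image-⊆ id id) (∈-image⁺ id)

img-surjective : (σ : Fin a → Fin b) → StrictlySurjective _≡_ σ → img σ ≡ ⊤
img-surjective σ surj = ⊆-antisym (λ _ → ∈⊤) (λ {y} _ → hit (surj y))
  where
  hit : ∀ {y} → ∃[ x ] σ x ≡ y → y ∈ img σ
  hit (x , refl) = ∈-image⁺ σ ∈⊤

image-injective : (σ : Fin a → Fin b) → Injective _≡_ _≡_ σ → ∀ {s t} → image σ s ≡ image σ t → s ≡ t
image-injective σ σ-inj σs≡σt = ⊆-antisym (reflect σs≡σt) (reflect (sym σs≡σt))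
  where
  reflect : ∀ {s t} → image σ s ≡ image σ t → s ⊆ t
  reflect {s} {t} eq x∈s with ∈-image⁻ σ (subst (_ ∈_) eq (∈-image⁺ σ x∈s))
  ... | x′ , x′∈t , σx′≡σx = subst (_∈ t) (σ-inj σx′≡σx) x′∈t

∈-insertAt-punchIn : ∀ {s : Subset m} {y} j b → y ∈ s → punchIn j y ∈ insertAt s j b
∈-insertAt-punchIn {s = s} {y} j b y∈s =
  lookup⇒[]= _ _ (trans (insertAt-punchIn s j b y) ([]=⇒lookup y∈s))

image-punchIn : (j : Fin (suc m)) (s : Subset m) → image (punchIn j) s ≡ insertAt s j outside
image-punchIn j s = ⊆-antisym (image-⊆ _ (∈-insertAt-punchIn j outside)) back
  where
  back : insertAt s j outside ⊆ image (punchIn j) s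
  back {y} y∈ with j ≟ y
  ... | yes refl with () ← trans (sym (insertAt-lookup s j outside)) ([]=⇒lookup y∈)
  ... | no j≢y = subst (_∈ image (punchIn j) s) (punchIn-punchOut j≢y) (∈-image⁺ (punchIn j)
        (lookup⇒[]= _ s (trans (sym (insertAt-punchIn s j outside _))
          (trans (cong (lookup (insertAt s j outside)) (punchIn-punchOut j≢y)) ([]=⇒lookup y∈)))))

insertAt-∩-outside : (s t : Subset m) (j : Fin (suc m)) (b : Bool) →
  insertAt s j b ∩ insertAt t j outside ≡ insertAt (s ∩ t) j outside
insertAt-∩-outside s t zero b = cong (_∷ s ∩ t) (∧-zeroʳ b)
insertAt-∩-outside (x ∷ s) (y ∷ t) (suc j) b = cong (x ∧ y ∷_) (insertAt-∩-outside s t j b)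

insertAt-injective : ∀ {s t : Subset m} j {b b′} → insertAt s j b ≡ insertAt t j b′ → s ≡ t
insertAt-injective {s = s} {t} j {b} {b′} eq =
  trans (sym (removeAt-insertAt s j b)) (trans (cong (λ v → removeAt v j) eq) (removeAt-insertAt t j b′))

image-section : (σ : Fin a → Fin b) (σ⁻ : Fin b → Fin a) → (∀ y → σ (σ⁻ y) ≡ y) →
  ∀ s → image σ (image σ⁻ s) ≡ s
image-section σ σ⁻ σσ⁻≗id s = trans (sym (image-∘ σ σ⁻ s)) (trans (image-cong σσ⁻≗id s) (image-id s))

edge-nonempty : ∀ H {e} → IsEdge H e → Nonempty e
edge-nonempty H {e} e∈H with nonempty? e
... | yes ne = ne
... | no ¬ne with () ← trans (sym e∈H) (trans (cong (E H) (Empty-unique ¬ne)) (E-ne H))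

isTrimHom-resp-≗ : ∀ H G {φ ψ : Fin (n H) → Fin (n G)} → φ ≗ ψ → IsTrimHom H G φ → IsTrimHom H G ψ
isTrimHom-resp-≗ H G φ≗ψ hom e e∈H with hom e e∈H
... | e′ , e′∈G , φe≡ =
  e′ , e′∈G , trans (sym (image-cong φ≗ψ e)) (trans φe≡ (cong (e′ ∩_) (image-cong φ≗ψ ⊤)))

id-isTrimHom : ∀ H → IsTrimHom H H id
id-isTrimHom H e e∈H = e , e∈H , trans (image-id e) (sym (trans (cong (e ∩_) (image-id ⊤)) (∩-identityʳ e)))

surjective-trimHom-preserves-edges : ∀ H G {σ} → IsTrimHom H G σ → StrictlySurjective _≡_ σ →
  ∀ {e} → IsEdge H e → IsEdge G (image σ e)
surjective-trimHom-preserves-edges H G {σ} hom surj {e} e∈H with hom e e∈H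
... | e′ , e′∈G , σe≡ = subst (IsEdge G) σe≡e′ e′∈G
  where
  σe≡e′ : e′ ≡ image σ e
  σe≡e′ = sym (trans σe≡ (trans (cong (e′ ∩_) (img-surjective σ surj)) (∩-identityʳ e′)))

isTrimHom-∘-iso : ∀ H₁ H₂ ((f , f-edges) : H₁ ≅ H₂) G φ →
  IsTrimHom H₂ G φ ⇔ IsTrimHom H₁ G (φ ∘ Bijection.to f)
isTrimHom-∘-iso H₁ H₂ (f , f-edges) G φ = mk⇔ pull push
  where
  π : Permutation (n H₁) (n H₂)
  π = ⤖⇒↔ f
  σ : Fin (n H₁) → Fin (n H₂)
  σ = π ⟨$⟩ʳ_
  img-φσ : img (φ ∘ σ) ≡ img φ
  img-φσ = trans (image-∘ φ σ ⊤) (cong (image φ) (img-surjective σ (λ y → π ⟨$⟩ˡ y , inverseʳ π)))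
  σσ⁻ : ∀ e → image σ (image (π ⟨$⟩ˡ_) e) ≡ e
  σσ⁻ = image-section σ (π ⟨$⟩ˡ_) (λ _ → inverseʳ π)
  pull : IsTrimHom H₂ G φ → IsTrimHom H₁ G (φ ∘ σ)
  pull hom e e∈H₁ with hom (image σ e) (trans (f-edges e) e∈H₁)
  ... | e′ , e′∈G , eq = e′ , e′∈G , trans (image-∘ φ σ e) (trans eq (cong (e′ ∩_) (sym img-φσ)))
  push : IsTrimHom H₁ G (φ ∘ σ) → IsTrimHom H₂ G φ
  push hom e e∈H₂
    with hom (image (π ⟨$⟩ˡ_) e) (trans (sym (f-edges _)) (trans (cong (E H₂) (σσ⁻ e)) e∈H₂))
  ... | e′ , e′∈G , eq = e′ , e′∈G ,
    trans (cong (image φ) (sym (σσ⁻ e))) (trans (sym (image-∘ φ σ _)) (trans eq (cong (e′ ∩_) img-φσ)))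

-- Counting by sums over function spaces

𝟙 : ∀ {P : Set} → Dec P → ℕ
𝟙 P? = if does P? then 1 else 0

𝟙-⇔ : ∀ {P Q : Set} → P ⇔ Q → (P? : Dec P) (Q? : Dec Q) → 𝟙 P? ≡ 𝟙 Q?
𝟙-⇔ P⇔Q P? Q? = cong (λ b → if b then 1 else 0) (does-⇔ P⇔Q P? Q?)

𝟙-resp : ∀ {A : Set} {_≈_ : A → A → Set} {P : A → Set} (P? : ∀ x → Dec (P x)) →
  Symmetric _≈_ → P Respects _≈_ → Congruent _≈_ _≡_ (λ x → 𝟙 (P? x))
𝟙-resp P? ≈-sym resp x≈y = 𝟙-⇔ (mk⇔ (resp x≈y) (resp (≈-sym x≈y))) (P? _) (P? _)

𝟙-yes : ∀ {P : Set} (P? : Dec P) → P → 𝟙 P? ≡ 1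
𝟙-yes P? p = cong (λ b → if b then 1 else 0) (dec-true P? p)

𝟙-no : ∀ {P : Set} (P? : Dec P) → ¬ P → 𝟙 P? ≡ 0
𝟙-no P? ¬p = cong (λ b → if b then 1 else 0) (dec-false P? ¬p)

𝟙-pos : ∀ {P : Set} (P? : Dec P) → 0 < 𝟙 P? → P
𝟙-pos (yes p) _ = p

𝟙-× : ∀ {P Q : Set} (P? : Dec P) (Q? : Dec Q) → 𝟙 (P? ×-dec Q?) ≡ 𝟙 P? * 𝟙 Q?
𝟙-× (yes _) (yes _) = refl
𝟙-× (yes _) (no _)  = refl
𝟙-× (no _)  _       = refl

𝟙-split : ∀ {P Q R : Set} (P? : Dec P) (Q? : Dec Q) (R? : Dec R) →
  (Q → P) → (Q → ¬ R) → (P → ¬ R → Q) → 𝟙 P? ≡ 𝟙 Q? + 𝟙 R? * 𝟙 P?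
𝟙-split (yes p) (yes q) (yes r) Q⇒P Q⇒¬R P⇒¬R⇒Q = ⊥-elim (Q⇒¬R q r)
𝟙-split (yes p) (no ¬q) (no ¬r) Q⇒P Q⇒¬R P⇒¬R⇒Q = ⊥-elim (¬q (P⇒¬R⇒Q p ¬r))
𝟙-split (no ¬p) (yes q) _       Q⇒P Q⇒¬R P⇒¬R⇒Q = ⊥-elim (¬p (Q⇒P q))
𝟙-split (yes _) (yes _) (no _)  _   _    _      = refl
𝟙-split (yes _) (no _)  (yes _) _   _    _      = refl
𝟙-split (no _)  (no _)  (yes _) _   _    _      = refl
𝟙-split (no _)  (no _)  (no _)  _   _    _      = refl

length-filter : ∀ {A : Set} {P : A → Set} (P? : ∀ x → Dec (P x)) xs →
  length (filter P? xs) ≡ List.sum (map (𝟙 ∘ P?) xs)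
length-filter P? [] = refl
length-filter P? (x ∷ xs) with does (P? x)
... | true  = cong suc (length-filter P? xs)
... | false = length-filter P? xs

sum-concatMap : ∀ {A : Set} (g : A → List ℕ) xs → List.sum (concatMap g xs) ≡ List.sum (map (List.sum ∘ g) xs)
sum-concatMap g []       = refl
sum-concatMap g (x ∷ xs) = trans (sum-++ (g x) (concatMap g xs)) (cong (List.sum (g x) +_) (sum-concatMap g xs))

sum-map-allFin : ∀ b (h : Fin b → ℕ) → List.sum (map h (allFin b)) ≡ sum h
sum-map-allFin b h = trans (cong List.sum (map-tabulate id h)) (sum-tabulate b h)
  where
  sum-tabulate : ∀ b (h : Fin b → ℕ) → List.sum (Data.List.tabulate h) ≡ sum h
  sum-tabulate zero    h = refl
  sum-tabulate (suc b) h = cong (h zero +_) (sum-tabulate b (h ∘ suc))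

sumHead : ((Fin (suc a) → Fin b) → ℕ) → (Fin a → Fin b) → ℕ
sumHead w f = sum (λ y → w (consF y f))

sumFun : ∀ a b → ((Fin a → Fin b) → ℕ) → ℕ
sumFun zero    b w = w (λ ())
sumFun (suc a) b w = sumFun a b (sumHead w)

consF-cong : ∀ (y : Fin b) {f g : Fin a → Fin b} → f ≗ g → consF y f ≗ consF y g
consF-cong y f≗g zero    = refl
consF-cong y f≗g (suc i) = f≗g i

sumHead-cong : {w : (Fin (suc a) → Fin b) → ℕ} → Congruent _≗_ _≡_ w → Congruent _≗_ _≡_ (sumHead w)
sumHead-cong w-cong f≗g = sum-cong-≗ (λ y → w-cong (consF-cong y f≗g))

sum-map-allFuns : ∀ a b (w : (Fin a → Fin b) → ℕ) → List.sum (map w (allFuns a b)) ≡ sumFun a b w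
sum-map-allFuns zero    b w = +-identityʳ (w _)
sum-map-allFuns (suc a) b w = begin
  List.sum (map w (concatMap (λ f → map (λ y → consF y f) (allFin b)) (allFuns a b)))
    ≡⟨ cong List.sum (map-concatMap w _ (allFuns a b)) ⟩
  List.sum (concatMap (λ f → map w (map (λ y → consF y f) (allFin b))) (allFuns a b))
    ≡⟨ sum-concatMap _ (allFuns a b) ⟩
  List.sum (map (λ f → List.sum (map w (map (λ y → consF y f) (allFin b)))) (allFuns a b))
    ≡⟨ cong List.sum (map-cong (λ f → trans (cong List.sum (sym (map-∘ (allFin b)))) (sum-map-allFin b _))
                               (allFuns a b)) ⟩
  List.sum (map (sumHead w) (allFuns a b))
    ≡⟨ sum-map-allFuns a b (sumHead w) ⟩
  sumFun (suc a) b w ∎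
  where open ≡-Reasoning

#TrimHom-sumFun : ∀ H G → #TrimHom H G ≡ sumFun (n H) (n G) (λ φ → 𝟙 (isTrimHom? H G φ))
#TrimHom-sumFun H G = trans (length-filter (isTrimHom? H G) (allFuns (n H) (n G))) (sum-map-allFuns (n H) (n G) _)

sumFun-cong : ∀ a b {v w : (Fin a → Fin b) → ℕ} → (∀ f → v f ≡ w f) → sumFun a b v ≡ sumFun a b w
sumFun-cong zero    b v≗w = v≗w _
sumFun-cong (suc a) b v≗w = sumFun-cong a b (λ f → sum-cong-≗ (λ y → v≗w (consF y f)))

sumFun-+ : ∀ a b (v w : (Fin a → Fin b) → ℕ) → sumFun a b (λ f → v f + w f) ≡ sumFun a b v + sumFun a b w
sumFun-+ zero    b v w = refl
sumFun-+ (suc a) b v w =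
  trans (sumFun-cong a b (λ f → ∑-distrib-+ (λ y → v (consF y f)) (λ y → w (consF y f)))) (sumFun-+ a b _ _)

≤-sum : ∀ {b} (h : Fin b → ℕ) y → h y ≤ sum h
≤-sum {suc b} h y = ≤-trans (m≤m+n (h y) _) (≤-reflexive (sym (sum-remove {i = y} h)))

sum-pos : ∀ {b} (h : Fin b → ℕ) → 0 < sum h → ∃[ y ] 0 < h y
sum-pos {suc b} h pos with h zero in eq
... | suc _ = zero , subst (0 <_) (sym eq) z<s
... | zero  = Data.Product.map suc id (sum-pos (h ∘ suc) pos)

≤-sumFun : ∀ a b (w : (Fin a → Fin b) → ℕ) → Congruent _≗_ _≡_ w → ∀ f → w f ≤ sumFun a b w
≤-sumFun zero    b w w-cong f = ≤-reflexive (w-cong (λ ()))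
≤-sumFun (suc a) b w w-cong f = begin
  w f                          ≡⟨ w-cong (λ { zero → refl ; (suc i) → refl }) ⟩
  w (consF (f zero) (f ∘ suc)) ≤⟨ ≤-sum _ (f zero) ⟩
  sumHead w (f ∘ suc)          ≤⟨ ≤-sumFun a b (sumHead w) (sumHead-cong w-cong) (f ∘ suc) ⟩
  sumFun (suc a) b w           ∎
  where open ≤-Reasoning

sumFun-pos : ∀ a b (w : (Fin a → Fin b) → ℕ) → 0 < sumFun a b w → ∃[ f ] 0 < w f
sumFun-pos zero    b w pos = _ , pos
sumFun-pos (suc a) b w pos with sumFun-pos a b (sumHead w) pos
... | f , pos′ with sum-pos _ pos′
... | y , pos″ = consF y f , pos″

-- Covering counts and vertex deletion

Misses : Fin m → (Fin a → Fin m) → Set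
Misses j φ = ∀ x → φ x ≢ j

misses? : (j : Fin m) (φ : Fin a → Fin m) → Dec (Misses j φ)
misses? j φ = all? (λ x → ¬? (φ x ≟ j))

misses-consF : (j : Fin m) (y : Fin m) (f : Fin a → Fin m) → Misses j (consF y f) ⇔ (y ≢ j × Misses j f)
misses-consF j y f = mk⇔ (λ misses → misses zero , misses ∘ suc)
  (λ { (y≢j , misses) zero → y≢j ; (y≢j , misses) (suc x) → misses x })

𝟙-misses-consF : (j : Fin m) (y : Fin m) (f : Fin a → Fin m) →
  𝟙 (misses? j (consF y f)) ≡ 𝟙 (¬? (y ≟ j)) * 𝟙 (misses? j f)
𝟙-misses-consF j y f = trans (𝟙-⇔ (misses-consF j y f) (misses? j (consF y f)) (¬? (y ≟ j) ×-dec misses? j f))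
  (𝟙-× (¬? (y ≟ j)) (misses? j f))

∑-punchIn : (j : Fin (suc m)) (h : Fin (suc m) → ℕ) →
  sum (λ y → 𝟙 (¬? (y ≟ j)) * h y) ≡ sum (h ∘ punchIn j)
∑-punchIn j h = trans (sum-remove {i = j} (λ y → 𝟙 (¬? (y ≟ j)) * h y)) (cong₂ _+_
  (cong (_* h j) (𝟙-no (¬? (j ≟ j)) (λ j≢j → j≢j refl)))
  (sum-cong-≗ (λ y → trans (cong (_* h (punchIn j y)) (𝟙-yes (¬? (punchIn j y ≟ j)) (punchInᵢ≢i j y)))
                           (+-identityʳ _))))

sumFun-misses : ∀ a m (j : Fin (suc m)) (w : (Fin a → Fin (suc m)) → ℕ) → Congruent _≗_ _≡_ w →
  sumFun a (suc m) (λ φ → 𝟙 (misses? j φ) * w φ) ≡ sumFun a m (λ ψ → w (punchIn j ∘ ψ))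
sumFun-misses zero m j w w-cong = empty _ _
  where
  empty : ∀ f g → 𝟙 (misses? j f) * w f ≡ w (punchIn j ∘ g)
  empty f g = trans (cong (_* w f) (𝟙-yes (misses? j f) (λ ()))) (trans (+-identityʳ (w f)) (w-cong (λ ())))
sumFun-misses (suc a) m j w w-cong = begin
  sumFun a (suc m) (sumHead (λ φ → 𝟙 (misses? j φ) * w φ))
    ≡⟨ sumFun-cong a (suc m) factor ⟩
  sumFun a (suc m) (λ f → 𝟙 (misses? j f) * w′ f)
    ≡⟨ sumFun-misses a m j w′ (λ f≗g → sum-cong-≗ (λ y → w-cong (consF-cong (punchIn j y) f≗g))) ⟩
  sumFun a m (λ ψ → w′ (punchIn j ∘ ψ))
    ≡⟨ sumFun-cong a m (λ ψ → sum-cong-≗ (λ (y : Fin m) → w-cong (λ { zero → refl ; (suc i) → refl }))) ⟩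
  sumFun (suc a) m (λ ψ → w (punchIn j ∘ ψ)) ∎
  where
  open ≡-Reasoning
  w′ : (Fin a → Fin (suc m)) → ℕ
  w′ f = sum (λ y → w (consF (punchIn j y) f))
  split-misses : ∀ f y →
    𝟙 (misses? j (consF y f)) * w (consF y f) ≡ 𝟙 (misses? j f) * (𝟙 (¬? (y ≟ j)) * w (consF y f))
  split-misses f y = trans (cong (_* w (consF y f)) (𝟙-misses-consF j y f))
    (xy∙z≈y∙xz *-commutativeSemigroup (𝟙 (¬? (y ≟ j))) (𝟙 (misses? j f)) (w (consF y f)))
  factor : ∀ f → sumHead (λ φ → 𝟙 (misses? j φ) * w φ) f ≡ 𝟙 (misses? j f) * w′ f
  factor f = begin
    sum (λ y → 𝟙 (misses? j (consF y f)) * w (consF y f))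
      ≡⟨ sum-cong-≗ (split-misses f) ⟩
    sum (λ y → 𝟙 (misses? j f) * (𝟙 (¬? (y ≟ j)) * w (consF y f)))
      ≡⟨ *-distribˡ-sum (𝟙 (misses? j f)) (λ y → 𝟙 (¬? (y ≟ j)) * w (consF y f)) ⟨
    𝟙 (misses? j f) * sum (λ y → 𝟙 (¬? (y ≟ j)) * w (consF y f))
      ≡⟨ cong (𝟙 (misses? j f) *_) (∑-punchIn j (λ y → w (consF y f))) ⟩
    𝟙 (misses? j f) * w′ f ∎

sumFun-insertAt : ∀ a b (k : Fin (suc a)) (w : (Fin (suc a) → Fin b) → ℕ) → Congruent _≗_ _≡_ w →
  sumFun (suc a) b w ≡ sumFun a b (λ f → sum (λ y → w (Func.insertAt f k y)))
sumFun-insertAt a b zero w w-cong =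
  sumFun-cong a b (λ f → sum-cong-≗ (λ (y : Fin b) → w-cong (λ { zero → refl ; (suc i) → refl })))
sumFun-insertAt (suc a) b (suc k) w w-cong = begin
  sumFun (suc a) b (sumHead w)
    ≡⟨ sumFun-insertAt a b k (sumHead w) (sumHead-cong w-cong) ⟩
  sumFun a b (λ g → sum (λ y → sum (λ y₀ → w (consF y₀ (Func.insertAt g k y)))))
    ≡⟨ sumFun-cong a b (λ g → ∑-comm (λ y y₀ → w (consF y₀ (Func.insertAt g k y)))) ⟩
  sumFun a b (λ g → sum (λ y₀ → sum (λ y → w (consF y₀ (Func.insertAt g k y)))))
    ≡⟨ sumFun-cong a b (λ g → sum-cong-≗ (λ (y₀ : Fin b) → sum-cong-≗ (λ (y : Fin b) →
         w-cong (λ { zero → refl ; (suc i) → refl })))) ⟩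
  sumFun (suc a) b (λ f → sum (λ y → w (Func.insertAt f (suc k) y))) ∎
  where open ≡-Reasoning

sumFun-permute : ∀ {a a′} b (π : Permutation a a′) (w : (Fin a → Fin b) → ℕ) → Congruent _≗_ _≡_ w →
  sumFun a b w ≡ sumFun a′ b (λ φ → w (φ ∘ (π ⟨$⟩ʳ_)))
sumFun-permute {zero}  {zero}   b π w w-cong = w-cong (λ ())
sumFun-permute {zero}  {suc _}  b π = ⊥-elim (¬Fin0 (π ⟨$⟩ˡ zero))
sumFun-permute {suc _} {zero}   b π = ⊥-elim (¬Fin0 (π ⟨$⟩ʳ zero))
sumFun-permute {suc a} {suc a′} b π w w-cong = begin
  sumFun a b (sumHead w)
    ≡⟨ sumFun-permute b π₀ (sumHead w) (sumHead-cong w-cong) ⟩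
  sumFun a′ b (λ f → sum (λ y → w (consF y (f ∘ (π₀ ⟨$⟩ʳ_)))))
    ≡⟨ sumFun-cong a′ b (λ f → sum-cong-≗ (λ y → w-cong (reinsert f y))) ⟩
  sumFun a′ b (λ f → sum (λ y → w (Func.insertAt f k y ∘ (π ⟨$⟩ʳ_))))
    ≡⟨ sumFun-insertAt a′ b k (λ φ → w (φ ∘ (π ⟨$⟩ʳ_))) (λ φ≗ψ → w-cong (φ≗ψ ∘ (π ⟨$⟩ʳ_))) ⟨
  sumFun (suc a′) b (λ φ → w (φ ∘ (π ⟨$⟩ʳ_))) ∎
  where
  open ≡-Reasoning
  k : Fin (suc a′)
  k = π ⟨$⟩ʳ zero
  π₀ : Permutation a a′
  π₀ = remove zero π
  reinsert : ∀ f y → consF y (f ∘ (π₀ ⟨$⟩ʳ_)) ≗ Func.insertAt f k y ∘ (π ⟨$⟩ʳ_)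
  reinsert f y zero    = sym (Funcₚ.insertAt-lookup f k y)
  reinsert f y (suc i) = sym (trans (cong (Func.insertAt f k y) (punchIn-permute π zero i))
                                    (Funcₚ.insertAt-punchIn f k y (π₀ ⟨$⟩ʳ i)))

Covers : ℕ → (Fin a → Fin m) → Set
Covers c φ = ∀ y → toℕ y < c → ∃[ x ] φ x ≡ y

covers? : ∀ c (φ : Fin a → Fin m) → Dec (Covers c φ)
covers? c φ = all? (λ y → (toℕ y <? c) →-dec any? (λ x → φ x ≟ y))

covers-resp-≗ : ∀ {c} {φ ψ : Fin a → Fin m} → φ ≗ ψ → Covers c φ → Covers c ψ
covers-resp-≗ φ≗ψ covers y y<c with covers y y<c
... | x , φx≡y = x , trans (sym (φ≗ψ x)) φx≡y

covers-suc⇒covers : ∀ {c} {φ : Fin a → Fin m} → Covers (suc c) φ → Covers c φ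
covers-suc⇒covers covers y y<c = covers y (m<n⇒m<1+n y<c)

covers-suc⇒¬misses : ∀ (j : Fin m) {φ : Fin a → Fin m} → Covers (suc (toℕ j)) φ → ¬ Misses j φ
covers-suc⇒¬misses j covers misses with covers j ≤-refl
... | x , φx≡j = misses x φx≡j

covers-¬misses⇒covers-suc : ∀ (j : Fin m) {φ : Fin a → Fin m} →
  Covers (toℕ j) φ → ¬ Misses j φ → Covers (suc (toℕ j)) φ
covers-¬misses⇒covers-suc j {φ} covers ¬misses y y≤j with m<1+n⇒m<n∨m≡n y≤j
... | inj₁ y<j = covers y y<j
... | inj₂ y≡j with refl ← toℕ-injective y≡j =
  decidable-stable (any? (λ x → φ x ≟ j)) (λ ¬hit → ¬misses (λ x φx≡j → ¬hit (x , φx≡j)))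

toℕ-punchIn-< : (j : Fin (suc m)) (y : Fin m) → toℕ y < toℕ j → toℕ (punchIn j y) ≡ toℕ y
toℕ-punchIn-< (suc j) zero    _         = refl
toℕ-punchIn-< (suc j) (suc y) (s<s y<j) = cong suc (toℕ-punchIn-< j y y<j)

toℕ-≤-punchIn : (j : Fin (suc m)) (y : Fin m) → toℕ y ≤ toℕ (punchIn j y)
toℕ-≤-punchIn zero    y       = n≤1+n (toℕ y)
toℕ-≤-punchIn (suc j) zero    = z≤n
toℕ-≤-punchIn (suc j) (suc y) = s≤s (toℕ-≤-punchIn j y)

covers-punchIn : (j : Fin (suc m)) (ψ : Fin a → Fin m) → Covers (toℕ j) (punchIn j ∘ ψ) ⇔ Covers (toℕ j) ψ
covers-punchIn j ψ = mk⇔ restrict extend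
  where
  restrict : Covers (toℕ j) (punchIn j ∘ ψ) → Covers (toℕ j) ψ
  restrict covers y y<j with covers (punchIn j y) (subst (_< toℕ j) (sym (toℕ-punchIn-< j y y<j)) y<j)
  ... | x , eq = x , punchIn-injective j (ψ x) y eq
  extend : Covers (toℕ j) ψ → Covers (toℕ j) (punchIn j ∘ ψ)
  extend covers y y<j = hit (covers (punchOut j≢y) (≤-<-trans (toℕ-≤-punchIn j _) below))
    where
    j≢y : j ≢ y
    j≢y refl = <-irrefl refl y<j
    below : toℕ (punchIn j (punchOut j≢y)) < toℕ j
    below = subst (λ z → toℕ z < toℕ j) (sym (punchIn-punchOut j≢y)) y<j
    hit : ∃[ x ] ψ x ≡ punchOut j≢y → ∃[ x ] punchIn j (ψ x) ≡ y
    hit (x , ψx≡y′) = x , trans (cong (punchIn j) ψx≡y′) (punchIn-punchOut j≢y)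

#CoveringTrimHom : Hypergraph → Hypergraph → ℕ → ℕ
#CoveringTrimHom H K c = sumFun (n H) (n K) (λ φ → 𝟙 (isTrimHom? H K φ ×-dec covers? c φ))

covering-weight-cong : ∀ H K c → Congruent _≗_ _≡_ (λ φ → 𝟙 (isTrimHom? H K φ ×-dec covers? c φ))
covering-weight-cong H K c = 𝟙-resp (λ φ → isTrimHom? H K φ ×-dec covers? c φ) (λ φ≗ψ → sym ∘ φ≗ψ)
  (λ φ≗ψ → Data.Product.map (isTrimHom-resp-≗ H K φ≗ψ) (covers-resp-≗ {c = c} φ≗ψ))

#CoveringTrimHom-zero : ∀ H K → #CoveringTrimHom H K 0 ≡ #TrimHom H K
#CoveringTrimHom-zero H K = trans
  (sumFun-cong (n H) (n K) (λ φ → 𝟙-⇔ (mk⇔ proj₁ (λ hom → hom , λ _ ()))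
    (isTrimHom? H K φ ×-dec covers? 0 φ) (isTrimHom? H K φ)))
  (sym (#TrimHom-sumFun H K))

module VertexDeletion {m} (Eᴷ : Subset (suc m) → Bool) (Eᴷ-ne : Eᴷ ⊥ ≡ false) (j : Fin (suc m)) where

  K : Hypergraph
  K = record { n = suc m ; E = Eᴷ ; E-ne = Eᴷ-ne }

  extendsToEdge : Subset m → Bool
  extendsToEdge s = Eᴷ (insertAt s j outside) ∨ Eᴷ (insertAt s j inside)

  trace : Subset m → Bool
  trace s = does (nonempty? s) ∧ extendsToEdge s

  K∖j : Hypergraph
  K∖j = record
    { n    = m
    ; E    = trace
    ; E-ne = cong (_∧ extendsToEdge ⊥) (dec-false (nonempty? (⊥ {m})) λ { (_ , x∈⊥) → ∉⊥ x∈⊥ })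
    }

  trace⁺ : ∀ {s} b → Nonempty s → Eᴷ (insertAt s j b) ≡ true → trace s ≡ true
  trace⁺ {s} b ne edge = trans (cong (_∧ extendsToEdge s) (dec-true (nonempty? s) ne)) (extends b edge)
    where
    extends : ∀ b → Eᴷ (insertAt s j b) ≡ true → extendsToEdge s ≡ true
    extends false edge = cong (_∨ Eᴷ (insertAt s j inside)) edge
    extends true  edge = trans (cong (Eᴷ (insertAt s j outside) ∨_) edge) (∨-zeroʳ _)

  trace⁻ : ∀ {s} → trace s ≡ true → ∃[ b ] Eᴷ (insertAt s j b) ≡ true
  trace⁻ {s} tr with does (nonempty? s) | Eᴷ (insertAt s j outside) in out
  ... | true | true  = outside , out
  ... | true | false = inside , tr

  image-punchIn-∘ : (ψ : Fin a → Fin m) (e : Subset a) →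
    image (punchIn j ∘ ψ) e ≡ insertAt (image ψ e) j outside
  image-punchIn-∘ ψ e = trans (image-∘ (punchIn j) ψ e) (image-punchIn j (image ψ e))

  ∩-insertAt-outside : (e′ : Subset (suc m)) (t : Subset m) →
    e′ ∩ insertAt t j outside ≡ insertAt (removeAt e′ j ∩ t) j outside
  ∩-insertAt-outside e′ t =
    trans (cong (_∩ _) (sym (insertAt-removeAt e′ j))) (insertAt-∩-outside (removeAt e′ j) t j (lookup e′ j))

  isTrimHom-punchIn : ∀ H (ψ : Fin (n H) → Fin m) → IsTrimHom H K (punchIn j ∘ ψ) ⇔ IsTrimHom H K∖j ψ
  isTrimHom-punchIn H ψ = mk⇔ restrict extend
    where
    open ≡-Reasoning
    restrict : IsTrimHom H K (punchIn j ∘ ψ) → IsTrimHom H K∖j ψ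
    restrict hom e e∈H with hom e e∈H
    ... | e′ , e′∈K , eq = s , trace⁺ (lookup e′ j) s-nonempty s-edge , ψe≡
      where
      s : Subset m
      s = removeAt e′ j
      ψe≡ : image ψ e ≡ s ∩ img ψ
      ψe≡ = insertAt-injective j (begin
        insertAt (image ψ e) j outside   ≡⟨ image-punchIn-∘ ψ e ⟨
        image (punchIn j ∘ ψ) e          ≡⟨ eq ⟩
        e′ ∩ img (punchIn j ∘ ψ)         ≡⟨ cong (e′ ∩_) (image-punchIn-∘ ψ ⊤) ⟩
        e′ ∩ insertAt (img ψ) j outside  ≡⟨ ∩-insertAt-outside e′ (img ψ) ⟩
        insertAt (s ∩ img ψ) j outside   ∎)
      s-nonempty : Nonempty s
      s-nonempty with edge-nonempty H e∈H
      ... | x , x∈e = ψ x , proj₁ (x∈p∩q⁻ s (img ψ) (subst (ψ x ∈_) ψe≡ (∈-image⁺ ψ x∈e)))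
      s-edge : Eᴷ (insertAt s j (lookup e′ j)) ≡ true
      s-edge = trans (cong Eᴷ (insertAt-removeAt e′ j)) e′∈K
    extend : IsTrimHom H K∖j ψ → IsTrimHom H K (punchIn j ∘ ψ)
    extend hom e e∈H with hom e e∈H
    ... | s , s∈K∖j , eq with trace⁻ s∈K∖j
    ... | b , edge = insertAt s j b , edge , (begin
      image (punchIn j ∘ ψ) e                      ≡⟨ image-punchIn-∘ ψ e ⟩
      insertAt (image ψ e) j outside               ≡⟨ cong (λ t → insertAt t j outside) eq ⟩
      insertAt (s ∩ img ψ) j outside               ≡⟨ insertAt-∩-outside s (img ψ) j b ⟨
      insertAt s j b ∩ insertAt (img ψ) j outside  ≡⟨ cong (insertAt s j b ∩_) (image-punchIn-∘ ψ ⊤) ⟨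
      insertAt s j b ∩ img (punchIn j ∘ ψ)         ∎)

  #CoveringTrimHom-∖ : ∀ H →
    #CoveringTrimHom H K (toℕ j) ≡ #CoveringTrimHom H K (suc (toℕ j)) + #CoveringTrimHom H K∖j (toℕ j)
  #CoveringTrimHom-∖ H = begin
    sumFun (n H) (suc m) w
      ≡⟨ sumFun-cong (n H) (suc m) split ⟩
    sumFun (n H) (suc m) (λ φ → w′ φ + 𝟙 (misses? j φ) * w φ)
      ≡⟨ sumFun-+ (n H) (suc m) w′ (λ φ → 𝟙 (misses? j φ) * w φ) ⟩
    #CoveringTrimHom H K (suc c) + sumFun (n H) (suc m) (λ φ → 𝟙 (misses? j φ) * w φ)
      ≡⟨ cong (#CoveringTrimHom H K (suc c) +_) (sumFun-misses (n H) m j w (covering-weight-cong H K c)) ⟩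
    #CoveringTrimHom H K (suc c) + sumFun (n H) m (λ ψ → w (punchIn j ∘ ψ))
      ≡⟨ cong (#CoveringTrimHom H K (suc c) +_) (sumFun-cong (n H) m restrict) ⟩
    #CoveringTrimHom H K (suc c) + #CoveringTrimHom H K∖j c ∎
    where
    open ≡-Reasoning
    c : ℕ
    c = toℕ j
    w w′ : (Fin (n H) → Fin (suc m)) → ℕ
    w  φ = 𝟙 (isTrimHom? H K φ ×-dec covers? c φ)
    w′ φ = 𝟙 (isTrimHom? H K φ ×-dec covers? (suc c) φ)
    split : ∀ φ → w φ ≡ w′ φ + 𝟙 (misses? j φ) * w φ
    split φ = 𝟙-split (isTrimHom? H K φ ×-dec covers? c φ) (isTrimHom? H K φ ×-dec covers? (suc c) φ)
      (misses? j φ)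
      (Data.Product.map₂ covers-suc⇒covers) (covers-suc⇒¬misses j ∘ proj₂)
      (λ (hom , covers) ¬misses → hom , covers-¬misses⇒covers-suc j covers ¬misses)
    restrict : ∀ ψ → w (punchIn j ∘ ψ) ≡ 𝟙 (isTrimHom? H K∖j ψ ×-dec covers? c ψ)
    restrict ψ = 𝟙-⇔ (isTrimHom-punchIn H ψ ×-⇔ covers-punchIn j ψ)
      (isTrimHom? H K (punchIn j ∘ ψ) ×-dec covers? c (punchIn j ∘ ψ)) (isTrimHom? H K∖j ψ ×-dec covers? c ψ)

-- From equal counts to an isomorphism

#CoveringTrimHom-equal : ∀ H₁ H₂ → (∀ G → #TrimHom H₁ G ≡ #TrimHom H₂ G) →
  ∀ c K → c ≤ n K → #CoveringTrimHom H₁ K c ≡ #CoveringTrimHom H₂ K c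
#CoveringTrimHom-equal H₁ H₂ same zero K _ = begin
  #CoveringTrimHom H₁ K 0  ≡⟨ #CoveringTrimHom-zero H₁ K ⟩
  #TrimHom H₁ K            ≡⟨ same K ⟩
  #TrimHom H₂ K            ≡⟨ #CoveringTrimHom-zero H₂ K ⟨
  #CoveringTrimHom H₂ K 0  ∎
  where open ≡-Reasoning
#CoveringTrimHom-equal H₁ H₂ same (suc c) record { n = suc m ; E = Eᴷ ; E-ne = Eᴷ-ne } (s≤s c≤m) =
  +-cancelʳ-≡ (#CoveringTrimHom H₁ K∖j c) _ _ (begin
    #CoveringTrimHom H₁ K (suc c) + #CoveringTrimHom H₁ K∖j c
      ≡⟨ recurrence H₁ ⟨
    #CoveringTrimHom H₁ K c
      ≡⟨ #CoveringTrimHom-equal H₁ H₂ same c K (m≤n⇒m≤1+n c≤m) ⟩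
    #CoveringTrimHom H₂ K c
      ≡⟨ recurrence H₂ ⟩
    #CoveringTrimHom H₂ K (suc c) + #CoveringTrimHom H₂ K∖j c
      ≡⟨ cong (#CoveringTrimHom H₂ K (suc c) +_) (#CoveringTrimHom-equal H₁ H₂ same c K∖j c≤m) ⟨
    #CoveringTrimHom H₂ K (suc c) + #CoveringTrimHom H₁ K∖j c  ∎)
  where
  open ≡-Reasoning
  open VertexDeletion Eᴷ Eᴷ-ne (fromℕ< (s≤s c≤m))
  recurrence : ∀ H → #CoveringTrimHom H K c ≡ #CoveringTrimHom H K (suc c) + #CoveringTrimHom H K∖j c
  recurrence H = subst (λ c → #CoveringTrimHom H K c ≡ #CoveringTrimHom H K (suc c) + #CoveringTrimHom H K∖j c)
    (toℕ-fromℕ< (s≤s c≤m)) (#CoveringTrimHom-∖ H)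

SurjectiveTrimHom : Hypergraph → Hypergraph → Set
SurjectiveTrimHom H G = ∃[ φ ] IsTrimHom H G φ × StrictlySurjective _≡_ φ

surjective-trimHom : ∀ H₁ H₂ → (∀ G → #TrimHom H₁ G ≡ #TrimHom H₂ G) → SurjectiveTrimHom H₁ H₂
surjective-trimHom H₁ H₂ same with sumFun-pos (n H₁) (n H₂) _ counted
  where
  open ≤-Reasoning
  counted : 0 < #CoveringTrimHom H₁ H₂ (n H₂)
  counted = begin-strict
    0                          <⟨ z<s ⟩
    1                          ≡⟨ 𝟙-yes (isTrimHom? H₂ H₂ id ×-dec covers? (n H₂) (id {A = Fin (n H₂)}))
                                         (id-isTrimHom H₂ , λ y _ → y , refl) ⟨
    w id                       ≤⟨ ≤-sumFun (n H₂) (n H₂) w (covering-weight-cong H₂ H₂ (n H₂)) id ⟩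
    #CoveringTrimHom H₂ H₂ (n H₂)  ≡⟨ #CoveringTrimHom-equal H₁ H₂ same (n H₂) H₂ ≤-refl ⟨
    #CoveringTrimHom H₁ H₂ (n H₂)  ∎
    where
    w : (Fin (n H₂) → Fin (n H₂)) → ℕ
    w φ = 𝟙 (isTrimHom? H₂ H₂ φ ×-dec covers? (n H₂) φ)
... | φ , counted-φ with 𝟙-pos (isTrimHom? H₁ H₂ φ ×-dec covers? (n H₂) φ) counted-φ
... | hom , covers = φ , hom , λ y → covers y (toℕ<n y)

surjective⇒≥ : (φ : Fin a → Fin b) → StrictlySurjective _≡_ φ → b ≤ a
surjective⇒≥ φ surj = injective⇒≤ {f = proj₁ ∘ surj} section-injective
  where
  section-injective : Injective _≡_ _≡_ (proj₁ ∘ surj)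
  section-injective {y} {y′} eq = trans (sym (proj₂ (surj y))) (trans (cong φ eq) (proj₂ (surj y′)))

surjective⇒injective : (φ : Fin a → Fin b) → a ≤ b → StrictlySurjective _≡_ φ → Injective _≡_ _≡_ φ
surjective⇒injective {suc a} φ 1+a≤b surj {x₁} {x₂} φx₁≡φx₂ with x₁ ≟ x₂
... | yes x₁≡x₂ = x₁≡x₂
... | no x₁≢x₂ = ⊥-elim (<⇒≱ 1+a≤b (surjective⇒≥ (φ ∘ punchIn x₁) surj′))
  where
  surj′ : StrictlySurjective _≡_ (φ ∘ punchIn x₁)
  surj′ y with surj y
  ... | x , φx≡y with x₁ ≟ x
  ...   | yes refl =
    punchOut x₁≢x₂ , trans (cong φ (punchIn-punchOut x₁≢x₂)) (trans (sym φx₁≡φx₂) φx≡y)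
  ...   | no x₁≢x  = punchOut x₁≢x , trans (cong φ (punchIn-punchOut x₁≢x)) φx≡y

-- By pigeonhole θⁱ s = θʲ s for some i < j; cancelling θⁱ gives s = θʲ⁻ⁱ s.
injective-endomap-reflects : ∀ {A : Set} {N} (encode : A → Fin N) → Injective _≡_ _≡_ encode →
  (θ : A → A) → Injective _≡_ _≡_ θ →
  (P : A → Set) → (∀ {s} → P s → P (θ s)) → ∀ {s} → P (θ s) → P s
injective-endomap-reflects {N = N} encode encode-inj θ θ-inj P preserved {s} P-θs
  with i , j , i<j , eq ← pigeonhole (n<1+n N) (λ i → encode (fold s θ (toℕ i)))
  = returns (toℕ i) (toℕ j) i<j (encode-inj eq)
  where
  P-iterate : ∀ k → P (fold s θ (suc k))
  P-iterate zero    = P-θs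
  P-iterate (suc k) = preserved (P-iterate k)
  returns : ∀ i j → i < j → fold s θ i ≡ fold s θ j → P s
  returns zero    (suc k) _   s≡θᵏ⁺¹s = subst P (sym s≡θᵏ⁺¹s) (P-iterate k)
  returns (suc i) (suc j) i<j θⁱ⁺¹s≡θʲ⁺¹s = returns i j (s<s⁻¹ i<j) (θ-inj θⁱ⁺¹s≡θʲ⁺¹s)

encodeSubset : Subset m → Fin (2 ^ m)
encodeSubset s = funToFin (Inverse.from 2↔Bool ∘ lookup s)

encodeSubset-injective : Injective _≡_ _≡_ (encodeSubset {m})
encodeSubset-injective {x = s} {t} eq =
  trans (sym (tabulate∘lookup s)) (trans (tabulate-cong same-lookup) (tabulate∘lookup t))
  where
  same-lookup : lookup s ≗ lookup t
  same-lookup i = begin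
    lookup s i                                               ≡⟨ Inverse.strictlyInverseˡ 2↔Bool (lookup s i) ⟨
    Inverse.to 2↔Bool (Inverse.from 2↔Bool (lookup s i))     ≡⟨ cong (Inverse.to 2↔Bool) (finToFun-funToFin _ i) ⟨
    Inverse.to 2↔Bool (finToFun (encodeSubset s) i)          ≡⟨ cong (λ k → Inverse.to 2↔Bool (finToFun k i)) eq ⟩
    Inverse.to 2↔Bool (finToFun (encodeSubset t) i)          ≡⟨ cong (Inverse.to 2↔Bool) (finToFun-funToFin _ i) ⟩
    Inverse.to 2↔Bool (Inverse.from 2↔Bool (lookup t i))     ≡⟨ Inverse.strictlyInverseˡ 2↔Bool (lookup t i) ⟩
    lookup t i                                               ∎
    where open ≡-Reasoning

≡true⇔≡true⇒≡ : ∀ {x y : Bool} → (x ≡ true → y ≡ true) → (y ≡ true → x ≡ true) → x ≡ y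
≡true⇔≡true⇒≡ {false} {false} _   _   = refl
≡true⇔≡true⇒≡ {false} {true}  _   y⇒x = y⇒x refl
≡true⇔≡true⇒≡ {true}          x⇒y _   = sym (x⇒y refl)

surjective-trimHoms⇒≅ : ∀ H₁ H₂ → SurjectiveTrimHom H₁ H₂ → SurjectiveTrimHom H₂ H₁ → H₁ ≅ H₂
surjective-trimHoms⇒≅ H₁ H₂ (φ , φ-hom , φ-surj) (ψ , ψ-hom , ψ-surj) =
  mk⤖ {to = φ} (φ-inj , strictlySurjective⇒surjective φ-surj) , λ e → ≡true⇔≡true⇒≡ (reflect e) φ-edge
  where
  φ-inj : Injective _≡_ _≡_ φ
  φ-inj = surjective⇒injective φ (surjective⇒≥ ψ ψ-surj) φ-surj
  ψ-inj : Injective _≡_ _≡_ ψ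
  ψ-inj = surjective⇒injective ψ (surjective⇒≥ φ φ-surj) ψ-surj
  φ-edge : ∀ {e} → IsEdge H₁ e → IsEdge H₂ (image φ e)
  φ-edge = surjective-trimHom-preserves-edges H₁ H₂ φ-hom φ-surj
  ψ-edge : ∀ {e} → IsEdge H₂ e → IsEdge H₁ (image ψ e)
  ψ-edge = surjective-trimHom-preserves-edges H₂ H₁ ψ-hom ψ-surj
  θ : Subset (n H₁) → Subset (n H₁)
  θ s = image ψ (image φ s)
  reflect : ∀ e → IsEdge H₂ (image φ e) → IsEdge H₁ e
  reflect e φe-edge = injective-endomap-reflects encodeSubset encodeSubset-injective θ
    (image-injective φ φ-inj ∘ image-injective ψ ψ-inj) (IsEdge H₁) (ψ-edge ∘ φ-edge) (ψ-edge φe-edge)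

lemma6p5 : (H₁ H₂ : Hypergraph) →
    (H₁ ≅ H₂ → (G : Hypergraph) → #TrimHom H₁ G ≡ #TrimHom H₂ G) ×
    (((G : Hypergraph) → #TrimHom H₁ G ≡ #TrimHom H₂ G) → H₁ ≅ H₂)
lemma6p5 H₁ H₂ = same-counts , isomorphic
  where
  open ≡-Reasoning
  same-counts : H₁ ≅ H₂ → (G : Hypergraph) → #TrimHom H₁ G ≡ #TrimHom H₂ G
  same-counts iso@(f , _) G = begin
    #TrimHom H₁ G
      ≡⟨ #TrimHom-sumFun H₁ G ⟩
    sumFun (n H₁) (n G) (λ φ → 𝟙 (isTrimHom? H₁ G φ))
      ≡⟨ sumFun-permute (n G) (⤖⇒↔ f) (λ φ → 𝟙 (isTrimHom? H₁ G φ))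
           (𝟙-resp (isTrimHom? H₁ G) (λ φ≗ψ → sym ∘ φ≗ψ) (isTrimHom-resp-≗ H₁ G)) ⟩
    sumFun (n H₂) (n G) (λ φ → 𝟙 (isTrimHom? H₁ G (φ ∘ Bijection.to f)))
      ≡⟨ sumFun-cong (n H₂) (n G) (λ φ → 𝟙-⇔ (isTrimHom-∘-iso H₁ H₂ iso G φ)
           (isTrimHom? H₂ G φ) (isTrimHom? H₁ G (φ ∘ Bijection.to f))) ⟨
    sumFun (n H₂) (n G) (λ φ → 𝟙 (isTrimHom? H₂ G φ))
      ≡⟨ #TrimHom-sumFun H₂ G ⟨
    #TrimHom H₂ G ∎
  isomorphic : ((G : Hypergraph) → #TrimHom H₁ G ≡ #TrimHom H₂ G) → H₁ ≅ H₂
  isomorphic same =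
    surjective-trimHoms⇒≅ H₁ H₂ (surjective-trimHom H₁ H₂ same) (surjective-trimHom H₂ H₁ (sym ∘ same))
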